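{- Let $p$ and $q$ be primes. Then the cyclotomic polytope $\mathcal{C}_{pq}$ is simplicial.
   Context: Cyclotomic polytopes: for $p$ prime, $\mathcal{C}_p=\operatorname{conv}(e_1,\dots,e_{p-1},-\sum_ie_i)\subset\mathbb{R}^{p-1}$. For distinct primes $p,q$, $\mathcal{C}_{pq}=\mathcal{C}_p\otimes\mathcal{C}_q=\operatorname{conv}(v\otimes w: v \text{ a vertex of } \mathcal{C}_p, w \text{ a vertex of }\mathcal{C}_q)\subset\mathbb{R}^{p-1}\otimes\mathbb{R}^{q-1}$. For $p=q$, $\mathcal{C}_{p^2}$ is defined by identifying the $\mathbb{Z}$-basis element $\zeta^{k+jp}$ ($0\le k\le p-1$, $0\le j\le p-2$, $\zeta=e^{2\pi i/p^2}$) of $\mathbb{Z}[\zeta]$ with $e_{k(p-1)+j}\in\mathbb{R}^{p(p-1)}$ and taking the convex hull of the points representing all powers of $\zeta$.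
   Formalization: The cyclotomic polytopes lie in ℚ^n rather than in real space, so points have rational coordinates and the facet-defining inequalities and the coefficients of affine dependence are rational. -}

module Defs where

open import Data.Nat using (ℕ; zero; suc; _∸_; _≡ᵇ_) renaming (_*_ to _*ℕ_; _≤_ to _≤ℕ_)
open import Data.Fin using (Fin; toℕ; remQuot)
open import Data.Rational using (ℚ; 0ℚ; 1ℚ; _+_; _*_; _-_; -_; _≤_; _<_)
open import Data.Bool using (if_then_else_)
open import Data.Product using (Σ; ∃; _×_; _,_)
open import Relation.Binary.PropositionalEquality using (_≡_)

Point : ℕ → Set
Point d = Fin d → ℚ

_≈ₚ_ : ∀ {d} → Point d → Point d → Set
x ≈ₚ y = ∀ k → x k ≡ y k

Σℚ : ∀ {n} → (Fin n → ℚ) → ℚ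
Σℚ {zero}  f = 0ℚ
Σℚ {suc n} f = f Fin.zero + Σℚ (λ i → f (Fin.suc i))

_·_ : ∀ {d} → Point d → Point d → ℚ
a · x = Σℚ (λ i → a i * x i)

lincomb : ∀ {m d} → (Fin m → ℚ) → (Fin m → Point d) → Point d
lincomb c u k = Σℚ (λ j → c j * u j k)

ConvHull : ∀ {m d} → (Fin m → Point d) → Point d → Set
ConvHull {m} gens x =
  Σ (Fin m → ℚ) λ c → (∀ j → 0ℚ ≤ c j) × (Σℚ c ≡ 1ℚ) × (lincomb c gens ≈ₚ x)

Valid : ∀ {m d} → (Fin m → Point d) → Point d → ℚ → Set
Valid gens a b = ∀ j → a · gens j ≤ b

Face : ∀ {m d} → (Fin m → Point d) → Point d → ℚ → Point d → Set
Face gens a b x = ConvHull gens x × (a · x ≡ b)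

AffinelyIndependent : ∀ {k d} → (Fin k → Point d) → Set
AffinelyIndependent {k} u =
  ∀ (c : Fin k → ℚ) → Σℚ c ≡ 0ℚ → lincomb c u ≈ₚ (λ _ → 0ℚ) → ∀ i → c i ≡ 0ℚ

HasDim : ∀ {d} → (Point d → Set) → ℕ → Set
HasDim {d} S n =
  (Σ (Fin (suc n) → Point d) λ u → (∀ i → S (u i)) × AffinelyIndependent u)
  × (∀ k (u : Fin k → Point d) → (∀ i → S (u i)) → AffinelyIndependent u → k ≤ℕ suc n)

IsExtreme : ∀ {d} → (Point d → Set) → Point d → Set
IsExtreme {d} S x =
  S x × (∀ (y z : Point d) (t : ℚ) → S y → S z → 0ℚ < t → t < 1ℚ →
         x ≈ₚ (λ k → t * y k + (1ℚ - t) * z k) → y ≈ₚ z)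

IsSimplex : ∀ {d} → (Point d → Set) → Set
IsSimplex {d} S =
  ∀ k (u : Fin k → Point d) → (∀ i → IsExtreme S (u i)) →
  (∀ i j → u i ≈ₚ u j → i ≡ j) → AffinelyIndependent u

IsFacet : ∀ {m d} → (Fin m → Point d) → Point d → ℚ → Set
IsFacet gens a b =
  Valid gens a b × ∃ λ D → HasDim (ConvHull gens) (suc D) × HasDim (Face gens a b) D

Simplicial : ∀ {m d} → (Fin m → Point d) → Set
Simplicial {d = d} gens =
  ∀ (a : Point d) (b : ℚ) → IsFacet gens a b → IsSimplex (Face gens a b)

-- vertices of C_p ⊂ ℚ^{p-1}: index i < p-1 gives e_i, index p-1 gives -Σ e_k
cpVert : (p : ℕ) → Fin p → Point (p ∸ 1)
cpVert p i k =
  if toℕ i ≡ᵇ toℕ k then 1ℚ else (if toℕ i ≡ᵇ (p ∸ 1) then - 1ℚ else 0ℚ)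

-- C_{pq} = C_p ⊗ C_q ⊂ ℚ^{p-1} ⊗ ℚ^{q-1} ≅ ℚ^{(p-1)(q-1)},
-- coordinate (a,b) ↦ index a(q-1)+b;  generator (i,j) ↦ index iq+j
cpqGens : (p q : ℕ) → Fin (p *ℕ q) → Point ((p ∸ 1) *ℕ (q ∸ 1))
cpqGens p q t c with remQuot {p} q t | remQuot {p ∸ 1} (q ∸ 1) c
... | i , j | a , b = cpVert p i a * cpVert q j b

-- C_{p²} ⊂ ℚ^{p(p-1)}: generator index t = j·p + k (0 ≤ k ≤ p-1, 0 ≤ j ≤ p-1)
-- represents ζ^{k+jp}; basis element ζ^{k'+j'p} (j' ≤ p-2) is the
-- coordinate k'(p-1)+j'.  For j ≤ p-2, ζ^{k+jp} is that basis vector; for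
-- j = p-1, ζ^{k+(p-1)p} = - Σ_{j'≤p-2} ζ^{k+j'p} (since Φ_{p²}(ζ)=0).
cp2Gens : (p : ℕ) → Fin (p *ℕ p) → Point (p *ℕ (p ∸ 1))
cp2Gens p t c with remQuot {p} p t | remQuot {p} (p ∸ 1) c
... | j , k | k' , j' =
  if toℕ k ≡ᵇ toℕ k' then cpVert p j j' else 0ℚ

{-# OPTIONS --safe #-}

-- The vertices of a face {a·x = b} of conv(g) are generators g_j with a·g_j = b. So conv(g) is
-- simplicial as soon as, for every valid inequality a·x ≤ b that is strict at some generator,
-- the generators with a·g_j = b are linearly independent.
--
-- The generators of C_pq are v_i ⊗ w_j, where v_0, …, v_{p-1} and w_0, …, w_{q-1} are the vertices
-- of C_p and C_q. Their only linear relations are Σ_i v_i = 0 and Σ_j w_j = 0, so every row and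
-- every column of generators sums to 0 (which forces b > 0), and a linear relation
-- Σ C_ij v_i ⊗ w_j = 0 has C_ij = r_i + s_j. Let R = {i | r_i = r_0} and K = {j | s_j = -r_0}. Whenever exactly one of
-- i ∈ R and j ∈ K holds, C_ij ≠ 0, so a·(v_i ⊗ w_j) = b if the relation only involves tight
-- generators. Then the row sums over R minus the column sums over K give b (q |R| - p |K|) = 0.
-- As 0 < |R| ≤ p and p ∤ q, R and K contain every index, so C = 0.
--
-- The generators of C_{p²} are e_k ⊗ v_j, and a relation has C_jk = c_k for all j. If some
-- c_k ≠ 0, all p generators in column k are tight, and their sum 0 equals p b > 0.
module Submission where

open import Defs
open import Algebra.Bundles using (CommutativeRing)
open import Data.Bool using (Bool; true; false; if_then_else_; T)
open import Data.Empty using (⊥-elim)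
open import Data.Fin as Fin using (Fin; toℕ; combine; remQuot; _↑ˡ_; _↑ʳ_; inject₁; fromℕ)
import Data.Fin.Properties as Finₚ
open import Data.Fin.Relation.Unary.Top using (view; ‵fromℕ; ‵inject₁)
open import Data.Nat as ℕ using (ℕ; zero; suc; _≡ᵇ_)
open import Data.Nat.Divisibility using (divides; ∣⇒≤)
open import Data.Nat.Primality using (Prime; euclidsLemma; prime⇒irreducible; ¬prime[0]; ¬prime[1])
import Data.Nat.Properties as ℕₚ
open import Data.Product using (∃; _×_; _,_; proj₁; proj₂; map₂)
open import Data.Rational
  using (ℚ; 0ℚ; 1ℚ; ½; _+_; _*_; _-_; -_; 1/_; _≤_; _<_; ≢-nonZero; nonNegative; positive)
open import Data.Rational.Properties
open import Data.Rational.Solver using (module +-*-Solver)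
open import Data.Sum using (inj₁; inj₂)
open import Function using (_∘_)
open import Function.Bundles using (mk⇔)
open import Relation.Binary.PropositionalEquality
open import Relation.Nullary using (¬_; yes; no)
open import Relation.Nullary.Decidable
  using (does; ⌊_⌋; toWitness; fromWitness; decidable-stable; does-⇔; isYes≗does)

open import Algebra.Properties.Group +-0-group
  using (inverseˡ-unique; inverseʳ-unique; ⁻¹-involutive)
  renaming (x∙y⁻¹≈ε⇒x≈y to x-y≡0⇒x≡y; ∙-cancelˡ to +-cancelˡ)
open import Algebra.Properties.Ring +-*-ring using (-1*x≈-x; x[y-z]≈xy-xz; [y-z]x≈yx-zx)
open import Algebra.Properties.Semiring.Mult (CommutativeRing.semiring +-*-commutativeRing)
  using (×1-homo-*) renaming (_×_ to _×ₙ_)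
open import Algebra.Properties.Semiring.Sum (CommutativeRing.semiring +-*-commutativeRing)
  using (sum; sum-cong-≗; sum-replicate-zero; ∑-distrib-+; ∑-comm; *-distribˡ-sum; *-distribʳ-sum)
open +-*-Solver

0≤1 : 0ℚ ≤ 1ℚ
0≤1 = toWitness {a? = 0ℚ ≤? 1ℚ} _

0<1 : 0ℚ < 1ℚ
0<1 = toWitness {a? = 0ℚ <? 1ℚ} _

x≢0∧x*y≡0⇒y≡0 : ∀ {x y} → x ≢ 0ℚ → x * y ≡ 0ℚ → y ≡ 0ℚ
x≢0∧x*y≡0⇒y≡0 {x} {y} x≢0 xy≡0 = begin
  y               ≡⟨ *-identityˡ y ⟨
  1ℚ * y          ≡⟨ cong (_* y) (*-inverseˡ x) ⟨
  1/ x * x * y    ≡⟨ *-assoc (1/ x) x y ⟩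
  1/ x * (x * y)  ≡⟨ cong (1/ x *_) xy≡0 ⟩
  1/ x * 0ℚ       ≡⟨ *-zeroʳ (1/ x) ⟩
  0ℚ              ∎
  where
  instance _ = ≢-nonZero x≢0
  open ≡-Reasoning

x+u≡x-u⇒u≡0 : ∀ {x u} → x + 1ℚ * u ≡ x + - 1ℚ * u → u ≡ 0ℚ
x+u≡x-u⇒u≡0 {x} {u} x+u≡x-u = x≢0∧x*y≡0⇒y≡0 {1ℚ + 1ℚ} (λ ()) (begin
  (1ℚ + 1ℚ) * u                     ≡⟨ solve 2 (λ x u → (con 1ℚ :+ con 1ℚ) :* u
                                          := (x :+ con 1ℚ :* u) :- (x :+ con (- 1ℚ) :* u)) refl x u ⟩
  (x + 1ℚ * u) - (x + - 1ℚ * u)     ≡⟨ cong (_- (x + - 1ℚ * u)) x+u≡x-u ⟩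
  (x + - 1ℚ * u) - (x + - 1ℚ * u)   ≡⟨ +-inverseʳ (x + - 1ℚ * u) ⟩
  0ℚ                                ∎)
  where open ≡-Reasoning

≤∧≢⇒< : ∀ {x y} → x ≤ y → x ≢ y → x < y
≤∧≢⇒< {x} {y} x≤y x≢y with y ≤? x
... | yes y≤x = ⊥-elim (x≢y (≤-antisym x≤y y≤x))
... | no  y≰x = ≰⇒> y≰x

x≤y⇒0≤y-x : ∀ {x y} → x ≤ y → 0ℚ ≤ y - x
x≤y⇒0≤y-x {x} {y} x≤y = subst (_≤ y - x) (+-inverseʳ x) (+-monoˡ-≤ (- x) x≤y)

0≤x∧0≤y⇒0≤x*y : ∀ {x y} → 0ℚ ≤ x → 0ℚ ≤ y → 0ℚ ≤ x * y
0≤x∧0≤y⇒0≤x*y {x} {y} 0≤x 0≤y = subst (_≤ x * y) (*-zeroˡ y) (*-monoʳ-≤-nonNeg y {{nonNegative 0≤y}} 0≤x)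

0≤n×1 : ∀ n → 0ℚ ≤ n ×ₙ 1ℚ
0≤n×1 zero    = ≤-refl
0≤n×1 (suc n) = +-mono-≤ 0≤1 (0≤n×1 n)

×1-injective : ∀ m n → m ×ₙ 1ℚ ≡ n ×ₙ 1ℚ → m ≡ n
×1-injective zero    zero    _ = refl
×1-injective zero    (suc n) e = ⊥-elim (<⇒≢ (+-mono-<-≤ 0<1 (0≤n×1 n)) e)
×1-injective (suc m) zero    e = ⊥-elim (<⇒≢ (+-mono-<-≤ 0<1 (0≤n×1 m)) (sym e))
×1-injective (suc m) (suc n) e = cong suc (×1-injective m n (+-cancelˡ 1ℚ (m ×ₙ 1ℚ) (n ×ₙ 1ℚ) e))

Σℚ≗sum : ∀ {n} (f : Fin n → ℚ) → Σℚ f ≡ sum f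
Σℚ≗sum {zero}  f = refl
Σℚ≗sum {suc n} f = cong (f Fin.zero +_) (Σℚ≗sum (f ∘ Fin.suc))

Σℚ-cong : ∀ {n} {f g : Fin n → ℚ} → (∀ i → f i ≡ g i) → Σℚ f ≡ Σℚ g
Σℚ-cong {f = f} {g} f≗g = trans (Σℚ≗sum f) (trans (sum-cong-≗ f≗g) (sym (Σℚ≗sum g)))

Σℚ-zero : ∀ {n} {f : Fin n → ℚ} → (∀ i → f i ≡ 0ℚ) → Σℚ f ≡ 0ℚ
Σℚ-zero {n} f≗0 = trans (Σℚ-cong f≗0) (trans (Σℚ≗sum {n} (λ _ → 0ℚ)) (sum-replicate-zero n))

Σℚ-distrib-+ : ∀ {n} (f g : Fin n → ℚ) → Σℚ (λ i → f i + g i) ≡ Σℚ f + Σℚ g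
Σℚ-distrib-+ f g = begin
  Σℚ (λ i → f i + g i)   ≡⟨ Σℚ≗sum (λ i → f i + g i) ⟩
  sum (λ i → f i + g i)  ≡⟨ ∑-distrib-+ f g ⟩
  sum f + sum g          ≡⟨ cong₂ _+_ (Σℚ≗sum f) (Σℚ≗sum g) ⟨
  Σℚ f + Σℚ g            ∎
  where open ≡-Reasoning

Σℚ-*ˡ : ∀ {n} (x : ℚ) (f : Fin n → ℚ) → Σℚ (λ i → x * f i) ≡ x * Σℚ f
Σℚ-*ˡ x f = begin
  Σℚ (λ i → x * f i)   ≡⟨ Σℚ≗sum (λ i → x * f i) ⟩
  sum (λ i → x * f i)  ≡⟨ *-distribˡ-sum x f ⟨
  x * sum f            ≡⟨ cong (x *_) (Σℚ≗sum f) ⟨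
  x * Σℚ f             ∎
  where open ≡-Reasoning

Σℚ-*ʳ : ∀ {n} (x : ℚ) (f : Fin n → ℚ) → Σℚ (λ i → f i * x) ≡ Σℚ f * x
Σℚ-*ʳ x f = begin
  Σℚ (λ i → f i * x)   ≡⟨ Σℚ≗sum (λ i → f i * x) ⟩
  sum (λ i → f i * x)  ≡⟨ *-distribʳ-sum x f ⟨
  sum f * x            ≡⟨ cong (_* x) (Σℚ≗sum f) ⟨
  Σℚ f * x             ∎
  where open ≡-Reasoning

Σℚ-distrib-- : ∀ {n} (f g : Fin n → ℚ) → Σℚ (λ i → f i - g i) ≡ Σℚ f - Σℚ g
Σℚ-distrib-- f g = begin
  Σℚ (λ i → f i + - g i)        ≡⟨ Σℚ-distrib-+ f (λ i → - g i) ⟩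
  Σℚ f + Σℚ (λ i → - g i)       ≡⟨ cong (Σℚ f +_) (Σℚ-cong (λ i → -1*x≈-x (g i))) ⟨
  Σℚ f + Σℚ (λ i → - 1ℚ * g i)  ≡⟨ cong (Σℚ f +_) (trans (Σℚ-*ˡ (- 1ℚ) g) (-1*x≈-x (Σℚ g))) ⟩
  Σℚ f - Σℚ g                   ∎
  where open ≡-Reasoning

Σℚ-comm : ∀ {m n} (f : Fin m → Fin n → ℚ) → Σℚ (λ i → Σℚ (f i)) ≡ Σℚ (λ j → Σℚ (λ i → f i j))
Σℚ-comm f = begin
  Σℚ (λ i → Σℚ (f i))            ≡⟨ Σℚ-cong (λ i → Σℚ≗sum (f i)) ⟩
  Σℚ (λ i → sum (f i))           ≡⟨ Σℚ≗sum (λ i → sum (f i)) ⟩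
  sum (λ i → sum (f i))          ≡⟨ ∑-comm f ⟩
  sum (λ j → sum (λ i → f i j))  ≡⟨ Σℚ≗sum (λ j → sum (λ i → f i j)) ⟨
  Σℚ (λ j → sum (λ i → f i j))   ≡⟨ Σℚ-cong (λ j → Σℚ≗sum (λ i → f i j)) ⟨
  Σℚ (λ j → Σℚ (λ i → f i j))    ∎
  where open ≡-Reasoning

Σℚ²-distrib-- : ∀ {m n} (f g : Fin m → Fin n → ℚ) →
                Σℚ (λ i → Σℚ (λ j → f i j - g i j)) ≡ Σℚ (λ i → Σℚ (f i)) - Σℚ (λ i → Σℚ (g i))
Σℚ²-distrib-- f g = trans (Σℚ-cong (λ i → Σℚ-distrib-- (f i) (g i)))
                          (Σℚ-distrib-- (λ i → Σℚ (f i)) (λ i → Σℚ (g i)))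

Σℚ-++ : ∀ m {n} (f : Fin (m ℕ.+ n) → ℚ) → Σℚ f ≡ Σℚ (λ i → f (i ↑ˡ n)) + Σℚ (λ i → f (m ↑ʳ i))
Σℚ-++ zero    f = sym (+-identityˡ (Σℚ f))
Σℚ-++ (suc m) {n} f = trans (cong (f Fin.zero +_) (Σℚ-++ m (f ∘ Fin.suc)))
  (sym (+-assoc (f Fin.zero) (Σℚ (λ i → f (Fin.suc (i ↑ˡ n)))) (Σℚ (λ i → f (Fin.suc (m ↑ʳ i))))))

Σℚ-combine : ∀ m n (f : Fin (m ℕ.* n) → ℚ) → Σℚ f ≡ Σℚ (λ i → Σℚ (λ j → f (combine {m} {n} i j)))
Σℚ-combine zero    n f = refl
Σℚ-combine (suc m) n f =
  trans (Σℚ-++ n f) (cong (Σℚ (λ j → f (j ↑ˡ (m ℕ.* n))) +_) (Σℚ-combine m n (λ t → f (n ↑ʳ t))))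

Σℚ-const : ∀ n (x : ℚ) → Σℚ {n} (λ _ → x) ≡ (n ×ₙ 1ℚ) * x
Σℚ-const zero    x = sym (*-zeroˡ x)
Σℚ-const (suc n) x = trans (cong (x +_) (Σℚ-const n x))
  (solve 2 (λ x n → x :+ n :* x := (con 1ℚ :+ n) :* x) refl x (n ×ₙ 1ℚ))

Σℚ-mono-≤ : ∀ {n} {f g : Fin n → ℚ} → (∀ i → f i ≤ g i) → Σℚ f ≤ Σℚ g
Σℚ-mono-≤ {zero}  f≤g = ≤-refl
Σℚ-mono-≤ {suc n} f≤g = +-mono-≤ (f≤g Fin.zero) (Σℚ-mono-≤ (f≤g ∘ Fin.suc))

Σℚ-mono-< : ∀ {n} {f g : Fin n → ℚ} → (∀ i → f i ≤ g i) → ∀ j → f j < g j → Σℚ f < Σℚ g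
Σℚ-mono-< {suc n} f≤g Fin.zero    fj<gj = +-mono-<-≤ fj<gj (Σℚ-mono-≤ (f≤g ∘ Fin.suc))
Σℚ-mono-< {suc n} f≤g (Fin.suc j) fj<gj = +-mono-≤-< (f≤g Fin.zero) (Σℚ-mono-< (f≤g ∘ Fin.suc) j fj<gj)

Σℚ≢0⇒∃≢0 : ∀ {n} (f : Fin n → ℚ) → Σℚ f ≢ 0ℚ → ∃ λ i → f i ≢ 0ℚ
Σℚ≢0⇒∃≢0 {n} f Σf≢0 = Finₚ.¬∀⟶∃¬ n (λ i → f i ≡ 0ℚ) (λ i → f i ≟ 0ℚ) (Σf≢0 ∘ Σℚ-zero)

∀-combine : ∀ {m n} {S : Fin (m ℕ.* n) → Set} → (∀ i j → S (combine i j)) → ∀ t → S t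
∀-combine {m} {n} {S} S-combine t =
  subst S (Finₚ.combine-remQuot {m} n t) (S-combine (proj₁ (remQuot {m} n t)) (proj₂ (remQuot {m} n t)))

δ : ∀ {n} → Fin n → Fin n → ℚ
δ i j = if toℕ i ≡ᵇ toℕ j then 1ℚ else 0ℚ

δ-refl : ∀ {n} (i : Fin n) → δ i i ≡ 1ℚ
δ-refl Fin.zero    = refl
δ-refl (Fin.suc i) = δ-refl i

δ-≢ : ∀ {n} {i j : Fin n} → i ≢ j → δ i j ≡ 0ℚ
δ-≢ {i = Fin.zero}  {Fin.zero}  i≢j = ⊥-elim (i≢j refl)
δ-≢ {i = Fin.zero}  {Fin.suc j} _   = refl
δ-≢ {i = Fin.suc i} {Fin.zero}  _   = refl
δ-≢ {i = Fin.suc i} {Fin.suc j} i≢j = δ-≢ (i≢j ∘ cong Fin.suc)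

0≤δ : ∀ {n} (i j : Fin n) → 0ℚ ≤ δ i j
0≤δ i j with toℕ i ≡ᵇ toℕ j
... | true  = 0≤1
... | false = ≤-refl

δ≤1 : ∀ {n} (i j : Fin n) → δ i j ≤ 1ℚ
δ≤1 i j with toℕ i ≡ᵇ toℕ j
... | true  = ≤-refl
... | false = 0≤1

Σℚ-δ : ∀ {n} (f : Fin n → ℚ) (j : Fin n) → Σℚ (λ i → δ i j * f i) ≡ f j
Σℚ-δ {suc n} f Fin.zero = begin
  1ℚ * f Fin.zero + Σℚ (λ i → 0ℚ * f (Fin.suc i))
    ≡⟨ cong₂ _+_ (*-identityˡ (f Fin.zero)) (Σℚ-zero {n} (λ i → *-zeroˡ (f (Fin.suc i)))) ⟩
  f Fin.zero + 0ℚ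
    ≡⟨ +-identityʳ (f Fin.zero) ⟩
  f Fin.zero
    ∎
  where open ≡-Reasoning
Σℚ-δ {suc n} f (Fin.suc j) = begin
  0ℚ * f Fin.zero + Σ′  ≡⟨ cong (_+ Σ′) (*-zeroˡ (f Fin.zero)) ⟩
  0ℚ + Σ′               ≡⟨ +-identityˡ Σ′ ⟩
  Σ′                    ≡⟨ Σℚ-δ (f ∘ Fin.suc) j ⟩
  f (Fin.suc j)         ∎
  where
  open ≡-Reasoning
  Σ′ = Σℚ (λ i → δ i j * f (Fin.suc i))

term≤Σℚ : ∀ {n} {f : Fin n → ℚ} → (∀ i → 0ℚ ≤ f i) → ∀ j → f j ≤ Σℚ f
term≤Σℚ {f = f} f≥0 j = subst (_≤ Σℚ f) (Σℚ-δ f j) (Σℚ-mono-≤ δf≤f)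
  where
  δf≤f : ∀ i → δ i j * f i ≤ f i
  δf≤f i = subst (δ i j * f i ≤_) (*-identityˡ (f i))
                 (*-monoʳ-≤-nonNeg (f i) {{nonNegative (f≥0 i)}} (δ≤1 i j))

-- Faces and their vertices

·-cong : ∀ {d} (a : Point d) {x y : Point d} → x ≈ₚ y → a · x ≡ a · y
·-cong a x≈y = Σℚ-cong (λ i → cong (a i *_) (x≈y i))

·-lincomb : ∀ {m d} (a : Point d) (c : Fin m → ℚ) (g : Fin m → Point d) →
            a · lincomb c g ≡ Σℚ (λ j → c j * (a · g j))
·-lincomb a c g = begin
  Σℚ (λ i → a i * Σℚ (λ j → c j * g j i))    ≡⟨ Σℚ-cong (λ i → Σℚ-*ˡ (a i) (λ j → c j * g j i)) ⟨
  Σℚ (λ i → Σℚ (λ j → a i * (c j * g j i)))  ≡⟨ Σℚ-comm (λ i j → a i * (c j * g j i)) ⟩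
  Σℚ (λ j → Σℚ (λ i → a i * (c j * g j i)))  ≡⟨ Σℚ-cong (λ j → Σℚ-cong (λ i → swap (a i) (c j) (g j i))) ⟩
  Σℚ (λ j → Σℚ (λ i → c j * (a i * g j i)))  ≡⟨ Σℚ-cong (λ j → Σℚ-*ˡ (c j) (λ i → a i * g j i)) ⟩
  Σℚ (λ j → c j * (a · g j))                 ∎
  where
  open ≡-Reasoning
  swap : ∀ x y z → x * (y * z) ≡ y * (x * z)
  swap = solve 3 (λ x y z → x :* (y :* z) := y :* (x :* z)) refl

Σℚ-·-zero : ∀ {n d} (a : Point d) (h : Fin n → Point d) →
            (∀ k → Σℚ (λ j → h j k) ≡ 0ℚ) → Σℚ (λ j → a · h j) ≡ 0ℚ
Σℚ-·-zero a h Σh≡0 = trans (Σℚ-comm (λ j k → a k * h j k))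
  (Σℚ-zero (λ k → trans (Σℚ-*ˡ (a k) (λ j → h j k)) (trans (cong (a k *_) (Σh≡0 k)) (*-zeroʳ (a k)))))

convHull⊆hyperplane : ∀ {m d} {g : Fin m → Point d} {a : Point d} {b : ℚ} →
                      (∀ j → a · g j ≡ b) → ∀ {x} → ConvHull g x → a · x ≡ b
convHull⊆hyperplane {g = g} {a} {b} all-tight {x} (c , _ , Σc≡1 , c↦x) = begin
  a · x                       ≡⟨ ·-cong a c↦x ⟨
  a · lincomb c g             ≡⟨ ·-lincomb a c g ⟩
  Σℚ (λ j → c j * (a · g j))  ≡⟨ Σℚ-cong (λ j → cong (c j *_) (all-tight j)) ⟩
  Σℚ (λ j → c j * b)          ≡⟨ Σℚ-*ʳ b c ⟩
  Σℚ c * b                    ≡⟨ cong (_* b) Σc≡1 ⟩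
  1ℚ * b                      ≡⟨ *-identityˡ b ⟩
  b                           ∎
  where open ≡-Reasoning

-- If every generator were tight, the facet would be the whole polytope, of larger dimension.
facet⇒nonTight : ∀ {m d} {g : Fin m → Point d} {a : Point d} {b : ℚ} →
                 IsFacet g a b → ∃ λ j → a · g j < b
facet⇒nonTight {m} {g = g} {a} {b} (valid , D , ((u , u∈P , u-indep) , _) , (_ , face-bound)) =
  map₂ (λ {j} → ≤∧≢⇒< (valid j)) (Finₚ.¬∀⟶∃¬ m _ (λ j → a · g j ≟ b) all-tight⇒⊥)
  where
  all-tight⇒⊥ : ¬ (∀ j → a · g j ≡ b)
  all-tight⇒⊥ all-tight = ℕₚ.<-irrefl refl
    (face-bound (suc (suc D)) u (λ i → u∈P i , convHull⊆hyperplane {a = a} all-tight (u∈P i)) u-indep)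

centred⇒0<b : ∀ {m d} {g : Fin m → Point d} {a : Point d} {b : ℚ} → Valid g a b →
              (∃ λ t → a · g t < b) → Σℚ (λ t → a · g t) ≡ 0ℚ → 0ℚ < b
centred⇒0<b {m} {g = g} {a} {b} valid (t , t-nonTight) Σ≡0 = decidable-stable (0ℚ <? b) λ 0≮b →
  let b≤0 = ≮⇒≥ 0≮b in
  <-irrefl Σ≡0 (begin-strict
    Σℚ (λ t → a · g t)  <⟨ Σℚ-mono-< (λ t → ≤-trans (valid t) b≤0) t (<-≤-trans t-nonTight b≤0) ⟩
    Σℚ {m} (λ _ → 0ℚ)   ≡⟨ Σℚ-zero {m} (λ _ → refl) ⟩
    0ℚ                  ∎)
  where open ≤-Reasoning

positiveWeight⇒tight : ∀ {m d} {g : Fin m → Point d} {a : Point d} {b : ℚ} → Valid g a b →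
  ∀ {c : Fin m → ℚ} → (∀ l → 0ℚ ≤ c l) → Σℚ c ≡ 1ℚ → Σℚ (λ l → c l * (a · g l)) ≡ b →
  ∀ j → 0ℚ < c j → a · g j ≡ b
positiveWeight⇒tight {g = g} {a} {b} valid {c} c≥0 Σc≡1 Σc·ag≡b j 0<cj =
  decidable-stable (a · g j ≟ b) (λ nonTight → <-irrefl Σc·ag≡b (Σ<b (≤∧≢⇒< (valid j) nonTight)))
  where
  open ≤-Reasoning
  Σ<b : a · g j < b → Σℚ (λ l → c l * (a · g l)) < b
  Σ<b ag<b = begin-strict
    Σℚ (λ l → c l * (a · g l))  <⟨ Σℚ-mono-< (λ l → *-monoˡ-≤-nonNeg (c l) {{nonNegative (c≥0 l)}} (valid l))
                                             j (*-monoʳ-<-pos (c j) {{positive 0<cj}} ag<b) ⟩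
    Σℚ (λ l → c l * b)          ≡⟨ Σℚ-*ʳ b c ⟩
    Σℚ c * b                    ≡⟨ cong (_* b) Σc≡1 ⟩
    1ℚ * b                      ≡⟨ *-identityˡ b ⟩
    b                           ∎

-- For x = lincomb c g, lincomb (tilt c j s) g = x + s c_j (g_j − x). Writing the coefficients
-- as multiples of c l keeps them nonnegative for s = ±1.
tilt : ∀ {m} → (Fin m → ℚ) → Fin m → ℚ → Fin m → ℚ
tilt c j s l = c l * (1ℚ + s * (δ l j - c j))

Σℚ-tilt : ∀ {m} (c h : Fin m → ℚ) (j : Fin m) (s : ℚ) → let H = Σℚ (λ l → c l * h l) in
          Σℚ (λ l → tilt c j s l * h l) ≡ H + s * (c j * (h j - H))
Σℚ-tilt {m} c h j s = begin
  Σℚ (λ l → tilt c j s l * h l)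
    ≡⟨ Σℚ-cong (λ l → expand (c l) (h l) (δ l j)) ⟩
  Σℚ (λ l → ch l + s * (δ l j * ch l - c j * ch l))
    ≡⟨ Σℚ-distrib-+ ch (λ l → s * (δ l j * ch l - c j * ch l)) ⟩
  H + Σℚ (λ l → s * (δ l j * ch l - c j * ch l))
    ≡⟨ cong (H +_) (Σℚ-*ˡ s (λ l → δ l j * ch l - c j * ch l)) ⟩
  H + s * Σℚ (λ l → δ l j * ch l - c j * ch l)
    ≡⟨ cong (λ t → H + s * t) (Σℚ-distrib-- (λ l → δ l j * ch l) (λ l → c j * ch l)) ⟩
  H + s * (Σℚ (λ l → δ l j * ch l) - Σℚ (λ l → c j * ch l))
    ≡⟨ cong (λ t → H + s * t) (cong₂ _-_ (Σℚ-δ ch j) (Σℚ-*ˡ (c j) ch)) ⟩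
  H + s * (c j * h j - c j * H)
    ≡⟨ cong (λ t → H + s * t) (x[y-z]≈xy-xz (c j) (h j) H) ⟨
  H + s * (c j * (h j - H))
    ∎
  where
  open ≡-Reasoning
  ch : Fin m → ℚ
  ch l = c l * h l
  H = Σℚ ch
  expand : ∀ cl hl δl →
           cl * (1ℚ + s * (δl - c j)) * hl ≡ cl * hl + s * (δl * (cl * hl) - c j * (cl * hl))
  expand = solve 5 (λ s cj cl hl δl →
                      cl :* (con 1ℚ :+ s :* (δl :- cj)) :* hl
                        := cl :* hl :+ s :* (δl :* (cl :* hl) :- cj :* (cl :* hl)))
                   refl s (c j)

Σℚ-tilt-fixed : ∀ {m} (c h : Fin m → ℚ) (j : Fin m) (s : ℚ) {v : ℚ} →
                Σℚ (λ l → c l * h l) ≡ v → h j ≡ v → Σℚ (λ l → tilt c j s l * h l) ≡ v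
Σℚ-tilt-fixed c h j s {v} H≡v hj≡v = begin
  Σℚ (λ l → tilt c j s l * h l)  ≡⟨ Σℚ-tilt c h j s ⟩
  H + s * (c j * (h j - H))      ≡⟨ cong₂ (λ t u → t + s * (c j * (u - t))) H≡v hj≡v ⟩
  v + s * (c j * (v - v))        ≡⟨ solve 3 (λ v s cj → v :+ s :* (cj :* (v :- v)) := v) refl v s (c j) ⟩
  v                              ∎
  where
  open ≡-Reasoning
  H = Σℚ (λ l → c l * h l)

0≤tilt₊ : ∀ {m} {c : Fin m → ℚ} → (∀ l → 0ℚ ≤ c l) → Σℚ c ≡ 1ℚ → ∀ j l → 0ℚ ≤ tilt c j 1ℚ l
0≤tilt₊ {c = c} c≥0 Σc≡1 j l = 0≤x∧0≤y⇒0≤x*y (c≥0 l) (subst (0ℚ ≤_) rearrange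
  (+-mono-≤ (x≤y⇒0≤y-x (subst (c j ≤_) Σc≡1 (term≤Σℚ c≥0 j))) (0≤δ l j)))
  where
  rearrange = solve 2 (λ cj δl → (con 1ℚ :- cj) :+ δl := con 1ℚ :+ con 1ℚ :* (δl :- cj))
                      refl (c j) (δ l j)

0≤tilt₋ : ∀ {m} {c : Fin m → ℚ} → (∀ l → 0ℚ ≤ c l) → ∀ j l → 0ℚ ≤ tilt c j (- 1ℚ) l
0≤tilt₋ {c = c} c≥0 j l = 0≤x∧0≤y⇒0≤x*y (c≥0 l) (subst (0ℚ ≤_) rearrange
  (+-mono-≤ (x≤y⇒0≤y-x (δ≤1 l j)) (c≥0 j)))
  where
  rearrange = solve 2 (λ cj δl → (con 1ℚ :- δl) :+ cj := con 1ℚ :+ con (- 1ℚ) :* (δl :- cj))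
                      refl (c j) (δ l j)

tilt∈face : ∀ {m d} {g : Fin m → Point d} {a : Point d} {b : ℚ} {c : Fin m → ℚ} →
  Σℚ c ≡ 1ℚ → Σℚ (λ l → c l * (a · g l)) ≡ b → ∀ {j} → a · g j ≡ b →
  ∀ s → (∀ l → 0ℚ ≤ tilt c j s l) → Face g a b (lincomb (tilt c j s) g)
tilt∈face {g = g} {a} {c = c} Σc≡1 Σc·ag≡b {j} gj-tight s tilt≥0 =
  (tilt c j s , tilt≥0 , Σtilt≡1 , λ _ → refl) , a·tilt≡b
  where
  Σtilt≡1 = trans (Σℚ-cong (λ l → sym (*-identityʳ (tilt c j s l))))
                  (Σℚ-tilt-fixed c (λ _ → 1ℚ) j s (trans (Σℚ-cong (λ l → *-identityʳ (c l))) Σc≡1) refl)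
  a·tilt≡b = trans (·-lincomb a (tilt c j s) g) (Σℚ-tilt-fixed c (λ l → a · g l) j s Σc·ag≡b gj-tight)

-- x is the midpoint of x ± c_j (g_j − x), which lie in the face since g_j is tight.
extreme⇒generator : ∀ {m d} {g : Fin m → Point d} {a : Point d} {b : ℚ} → Valid g a b →
                    ∀ {x} → IsExtreme (Face g a b) x → ∃ λ j → x ≈ₚ g j × a · g j ≡ b
extreme⇒generator {g = g} {a} valid {x} (((c , c≥0 , Σc≡1 , c↦x) , a·x≡b) , extreme) =
  j , x≈gj , gj-tight
  where
  j-positive : ∃ λ j → 0ℚ < c j
  j-positive = map₂ (λ {j} cj≢0 → ≤∧≢⇒< (c≥0 j) (cj≢0 ∘ sym))
                    (Σℚ≢0⇒∃≢0 c (λ Σc≡0 → 1≢0 (trans (sym Σc≡1) Σc≡0)))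
  j = proj₁ j-positive
  0<cj = proj₂ j-positive

  Σc·ag≡b = trans (sym (·-lincomb a c g)) (trans (·-cong a c↦x) a·x≡b)
  gj-tight = positiveWeight⇒tight {g = g} {a} valid c≥0 Σc≡1 Σc·ag≡b j 0<cj

  u : Point _
  u k = c j * (g j k - x k)

  tilt-coord : ∀ s k → lincomb (tilt c j s) g k ≡ x k + s * u k
  tilt-coord s k = trans (Σℚ-tilt c (λ l → g l k) j s) (cong (λ t → t + s * (c j * (g j k - t))) (c↦x k))

  x-midpoint : x ≈ₚ (λ k → ½ * lincomb (tilt c j 1ℚ) g k + (1ℚ - ½) * lincomb (tilt c j (- 1ℚ)) g k)
  x-midpoint k = sym (trans (cong₂ (λ y z → ½ * y + (1ℚ - ½) * z) (tilt-coord 1ℚ k) (tilt-coord (- 1ℚ) k))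
    (solve 2 (λ x u → con ½ :* (x :+ con 1ℚ :* u) :+ (con 1ℚ :- con ½) :* (x :+ con (- 1ℚ) :* u) := x)
           refl (x k) (u k)))

  tilts-equal : lincomb (tilt c j 1ℚ) g ≈ₚ lincomb (tilt c j (- 1ℚ)) g
  tilts-equal = extreme _ _ ½ (tilt∈face {g = g} {a} Σc≡1 Σc·ag≡b gj-tight 1ℚ (0≤tilt₊ c≥0 Σc≡1 j))
                              (tilt∈face {g = g} {a} Σc≡1 Σc·ag≡b gj-tight (- 1ℚ) (0≤tilt₋ c≥0 j))
                              (toWitness {a? = 0ℚ <? ½} _) (toWitness {a? = ½ <? 1ℚ} _) x-midpoint

  x≈gj : x ≈ₚ g j
  x≈gj k = sym (x-y≡0⇒x≡y (g j k) (x k) (x≢0∧x*y≡0⇒y≡0 (≢-sym (<⇒≢ 0<cj))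
    (x+u≡x-u⇒u≡0 {x k} (trans (sym (tilt-coord 1ℚ k)) (trans (tilts-equal k) (tilt-coord (- 1ℚ) k))))))

LinearlyIndependentOn : ∀ {m d} → (Fin m → Point d) → (Fin m → Set) → Set
LinearlyIndependentOn {m} g S =
  ∀ (C : Fin m → ℚ) → (∀ t → ¬ S t → C t ≡ 0ℚ) → lincomb C g ≈ₚ (λ _ → 0ℚ) → ∀ t → C t ≡ 0ℚ

ProperFacesIndependent : ∀ {m d} → (Fin m → Point d) → Set
ProperFacesIndependent {d = d} g = ∀ (a : Point d) (b : ℚ) → Valid g a b → (∃ λ t → a · g t < b) →
                                   LinearlyIndependentOn g (λ t → a · g t ≡ b)

independentOn-∘-injective : ∀ {m d k} {g : Fin m → Point d} {S : Fin m → Set} →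
  LinearlyIndependentOn g S → (σ : Fin k → Fin m) → (∀ i i′ → σ i ≡ σ i′ → i ≡ i′) → (∀ i → S (σ i)) →
  ∀ (c : Fin k → ℚ) → lincomb c (g ∘ σ) ≈ₚ (λ _ → 0ℚ) → ∀ i → c i ≡ 0ℚ
independentOn-∘-injective {m} {g = g} {S} indep σ σ-injective σ∈S c c↦0 i = begin
  c i                        ≡⟨ Σℚ-δ c i ⟨
  Σℚ (λ i′ → δ i′ i * c i′)  ≡⟨ Σℚ-cong (λ i′ → cong (_* c i′) (δ-σ i′)) ⟨
  C (σ i)                    ≡⟨ indep C C-vanishes C↦0 (σ i) ⟩
  0ℚ                         ∎
  where
  open ≡-Reasoning
  C : Fin m → ℚ
  C t = Σℚ (λ i → δ t (σ i) * c i)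

  δ-σ : ∀ i′ → δ (σ i) (σ i′) ≡ δ i′ i
  δ-σ i′ with i′ Fin.≟ i
  ... | yes refl = trans (δ-refl (σ i)) (sym (δ-refl i))
  ... | no  i′≢i = trans (δ-≢ (i′≢i ∘ sym ∘ σ-injective i i′)) (sym (δ-≢ i′≢i))

  C-vanishes : ∀ t → ¬ S t → C t ≡ 0ℚ
  C-vanishes t t∉S = Σℚ-zero λ i →
    trans (cong (_* c i) (δ-≢ (λ t≡σi → t∉S (subst S (sym t≡σi) (σ∈S i))))) (*-zeroˡ (c i))

  C↦0 : lincomb C g ≈ₚ (λ _ → 0ℚ)
  C↦0 x = begin
    Σℚ (λ t → Σℚ (λ i → δ t (σ i) * c i) * g t x)
      ≡⟨ Σℚ-cong (λ t → Σℚ-*ʳ (g t x) (λ i → δ t (σ i) * c i)) ⟨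
    Σℚ (λ t → Σℚ (λ i → δ t (σ i) * c i * g t x))
      ≡⟨ Σℚ-comm (λ t i → δ t (σ i) * c i * g t x) ⟩
    Σℚ (λ i → Σℚ (λ t → δ t (σ i) * c i * g t x))
      ≡⟨ Σℚ-cong (λ i → Σℚ-cong (λ t → *-assoc (δ t (σ i)) (c i) (g t x))) ⟩
    Σℚ (λ i → Σℚ (λ t → δ t (σ i) * (c i * g t x)))
      ≡⟨ Σℚ-cong (λ i → Σℚ-δ (λ t → c i * g t x) (σ i)) ⟩
    lincomb c (g ∘ σ) x
      ≡⟨ c↦0 x ⟩
    0ℚ
      ∎

-- The vertices of a facet even turn out linearly independent.
properFacesIndependent⇒simplicial : ∀ {m d} {g : Fin m → Point d} → ProperFacesIndependent g → Simplicial g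
properFacesIndependent⇒simplicial {m} {g = g} indep a b facet@(valid , _) k u u-extreme u-distinct c _ c↦0 =
  independentOn-∘-injective (indep a b valid (facet⇒nonTight {g = g} {a} facet)) σ σ-injective σ-tight c
    (λ x → trans (Σℚ-cong (λ i → cong (c i *_) (sym (u≈gσ i x)))) (c↦0 x))
  where
  generator : ∀ i → ∃ λ j → u i ≈ₚ g j × a · g j ≡ b
  generator i = extreme⇒generator {g = g} {a} valid (u-extreme i)
  σ : Fin k → Fin m
  σ i = proj₁ (generator i)
  u≈gσ : ∀ i → u i ≈ₚ g (σ i)
  u≈gσ i = proj₁ (proj₂ (generator i))
  σ-tight : ∀ i → a · g (σ i) ≡ b
  σ-tight i = proj₂ (proj₂ (generator i))
  σ-injective : ∀ i i′ → σ i ≡ σ i′ → i ≡ i′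
  σ-injective i i′ σi≡σi′ = u-distinct i i′ λ x →
    trans (u≈gσ i x) (trans (cong (λ t → g t x) σi≡σi′) (sym (u≈gσ i′ x)))

χ : Bool → ℚ
χ true  = 1ℚ
χ false = 0ℚ

count : ∀ {n} → (Fin n → Bool) → ℕ
count {zero}  P = 0
count {suc n} P = (if P Fin.zero then 1 else 0) ℕ.+ count (P ∘ Fin.suc)

Σℚ-χ : ∀ {n} (P : Fin n → Bool) → Σℚ (χ ∘ P) ≡ count P ×ₙ 1ℚ
Σℚ-χ {zero}  P = refl
Σℚ-χ {suc n} P with P Fin.zero
... | true  = cong (1ℚ +_) (Σℚ-χ (P ∘ Fin.suc))
... | false = trans (+-identityˡ _) (Σℚ-χ (P ∘ Fin.suc))

count≤n : ∀ {n} (P : Fin n → Bool) → count P ℕ.≤ n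
count≤n {zero}  P = ℕ.z≤n
count≤n {suc n} P with P Fin.zero
... | true  = ℕ.s≤s (count≤n (P ∘ Fin.suc))
... | false = ℕₚ.m≤n⇒m≤1+n (count≤n (P ∘ Fin.suc))

count≡n⇒all : ∀ {n} (P : Fin n → Bool) → count P ≡ n → ∀ i → T (P i)
count≡n⇒all {suc n} P count≡n i with P Fin.zero in P0
count≡n⇒all {suc n} P count≡n Fin.zero    | true  = subst T (sym P0) _
count≡n⇒all {suc n} P count≡n (Fin.suc i) | true  = count≡n⇒all (P ∘ Fin.suc) (ℕₚ.suc-injective count≡n) i
... | false = ⊥-elim (ℕₚ.<-irrefl count≡n (ℕ.s≤s (count≤n (P ∘ Fin.suc))))

count>0 : ∀ {n} (P : Fin n → Bool) {i} → T (P i) → 0 ℕ.< count P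
count>0 {suc n} P {Fin.zero}  Pi with P Fin.zero | Pi
... | true | _ = ℕ.s≤s ℕ.z≤n
count>0 {suc n} P {Fin.suc i} Pi =
  ℕₚ.<-≤-trans (count>0 (P ∘ Fin.suc) Pi) (ℕₚ.m≤n+m _ (if P Fin.zero then 1 else 0))

-- Weighting the rows by x and the columns by y, the difference of the weighted sums only sees
-- the entries with x_i ≢ y_j, and these equal b.
weighted-balance : ∀ {p q} {M : Fin p → Fin q → ℚ} {b : ℚ} → b ≢ 0ℚ →
  (∀ i → Σℚ (M i) ≡ 0ℚ) → (∀ j → Σℚ (λ i → M i j) ≡ 0ℚ) →
  (x : Fin p → ℚ) (y : Fin q → ℚ) → (∀ i j → x i ≢ y j → M i j ≡ b) →
  (q ×ₙ 1ℚ) * Σℚ x ≡ (p ×ₙ 1ℚ) * Σℚ y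
weighted-balance {p} {q} {M} {b} b≢0 rows cols x y mismatch⇒b =
  x-y≡0⇒x≡y (Q * Σℚ x) (P * Σℚ y) (x≢0∧x*y≡0⇒y≡0 b≢0 (begin
    b * (Q * Σℚ x - P * Σℚ y)
      ≡⟨ solve 5 (λ b Q X P Y → b :* (Q :* X :- P :* Y) := Q :* (X :* b) :- P :* (Y :* b))
                 refl b Q (Σℚ x) P (Σℚ y) ⟩
    Q * (Σℚ x * b) - P * (Σℚ y * b)
      ≡⟨ cong₂ _-_ x-block y-block ⟨
    Σℚ (λ i → Σℚ {q} (λ _ → x i * b)) - Σℚ {p} (λ _ → Σℚ (λ j → y j * b))
      ≡⟨ Σℚ²-distrib-- (λ i _ → x i * b) (λ _ j → y j * b) ⟨
    Σℚ (λ i → Σℚ (λ j → x i * b - y j * b))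
      ≡⟨ Σℚ-cong (λ i → Σℚ-cong (λ j → mismatch-entry (mismatch⇒b i j))) ⟨
    Σℚ (λ i → Σℚ (λ j → x i * M i j - y j * M i j))
      ≡⟨ Σℚ²-distrib-- (λ i j → x i * M i j) (λ i j → y j * M i j) ⟩
    Σℚ (λ i → Σℚ (λ j → x i * M i j)) - Σℚ (λ i → Σℚ (λ j → y j * M i j))
      ≡⟨ cong₂ _-_ x-rows y-cols ⟩
    0ℚ - 0ℚ
      ≡⟨ +-inverseʳ 0ℚ ⟩
    0ℚ
      ∎))
  where
  open ≡-Reasoning
  P = p ×ₙ 1ℚ
  Q = q ×ₙ 1ℚ

  mismatch-entry : ∀ {xi yj m} → (xi ≢ yj → m ≡ b) → xi * m - yj * m ≡ xi * b - yj * b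
  mismatch-entry {xi} {yj} {m} m≡b with xi ≟ yj
  ... | yes refl = trans (+-inverseʳ (xi * m)) (sym (+-inverseʳ (xi * b)))
  ... | no  xi≢yj = cong (λ t → xi * t - yj * t) (m≡b xi≢yj)

  x-block : Σℚ (λ i → Σℚ {q} (λ _ → x i * b)) ≡ Q * (Σℚ x * b)
  x-block = trans (Σℚ-cong (λ i → Σℚ-const q (x i * b)))
                  (trans (Σℚ-*ˡ Q (λ i → x i * b)) (cong (Q *_) (Σℚ-*ʳ b x)))

  y-block : Σℚ {p} (λ _ → Σℚ (λ j → y j * b)) ≡ P * (Σℚ y * b)
  y-block = trans (Σℚ-cong {p} (λ _ → Σℚ-*ʳ b y)) (Σℚ-const p (Σℚ y * b))

  x-rows : Σℚ (λ i → Σℚ (λ j → x i * M i j)) ≡ 0ℚ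
  x-rows = Σℚ-zero (λ i → trans (Σℚ-*ˡ (x i) (M i)) (trans (cong (x i *_) (rows i)) (*-zeroʳ (x i))))

  y-cols : Σℚ (λ i → Σℚ (λ j → y j * M i j)) ≡ 0ℚ
  y-cols = trans (Σℚ-comm (λ i j → y j * M i j))
    (Σℚ-zero (λ j → trans (Σℚ-*ˡ (y j) (λ i → M i j)) (trans (cong (y j *_) (cols j)) (*-zeroʳ (y j)))))

block-count : ∀ {p q} {M : Fin p → Fin q → ℚ} {b : ℚ} → b ≢ 0ℚ →
  (∀ i → Σℚ (M i) ≡ 0ℚ) → (∀ j → Σℚ (λ i → M i j) ≡ 0ℚ) →
  (R : Fin p → Bool) (K : Fin q → Bool) → (∀ i j → R i ≢ K j → M i j ≡ b) →
  q ℕ.* count R ≡ p ℕ.* count K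
block-count {p} {q} b≢0 rows cols R K mismatch⇒b = ×1-injective _ _ (begin
  (q ℕ.* count R) ×ₙ 1ℚ        ≡⟨ ×1-homo-* q (count R) ⟩
  (q ×ₙ 1ℚ) * (count R ×ₙ 1ℚ)  ≡⟨ cong ((q ×ₙ 1ℚ) *_) (Σℚ-χ R) ⟨
  (q ×ₙ 1ℚ) * Σℚ (χ ∘ R)       ≡⟨ weighted-balance b≢0 rows cols (χ ∘ R) (χ ∘ K)
                                    (λ i j χRi≢χKj → mismatch⇒b i j (χRi≢χKj ∘ cong χ)) ⟩
  (p ×ₙ 1ℚ) * Σℚ (χ ∘ K)       ≡⟨ cong ((p ×ₙ 1ℚ) *_) (Σℚ-χ K) ⟩
  (p ×ₙ 1ℚ) * (count K ×ₙ 1ℚ)  ≡⟨ ×1-homo-* p (count K) ⟨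
  (p ℕ.* count K) ×ₙ 1ℚ        ∎)
  where open ≡-Reasoning

q*n≡p*k⇒n≡p : ∀ {p q n k} → Prime p → Prime q → p ≢ q → q ℕ.* n ≡ p ℕ.* k → 0 ℕ.< n → n ℕ.≤ p → n ≡ p
q*n≡p*k⇒n≡p {p} {q} {n} {k} p-prime q-prime p≢q q*n≡p*k 0<n n≤p
  with euclidsLemma q n p-prime (divides k (trans q*n≡p*k (ℕₚ.*-comm p k)))
... | inj₂ p∣n = ℕₚ.≤-antisym n≤p (∣⇒≤ {{ℕ.>-nonZero 0<n}} p∣n)
... | inj₁ p∣q with prime⇒irreducible q-prime p∣q
...   | inj₁ p≡1 = ⊥-elim (¬prime[1] (subst Prime p≡1 p-prime))
...   | inj₂ p≡q = ⊥-elim (p≢q p≡q)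

r+s-vanishes : ∀ {P Q} → Prime (suc P) → Prime (suc Q) → suc P ≢ suc Q →
  ∀ {M : Fin (suc P) → Fin (suc Q) → ℚ} {b : ℚ} → b ≢ 0ℚ →
  (∀ i → Σℚ (M i) ≡ 0ℚ) → (∀ j → Σℚ (λ i → M i j) ≡ 0ℚ) →
  (r : Fin (suc P) → ℚ) (s : Fin (suc Q) → ℚ) → (∀ i j → r i + s j ≢ 0ℚ → M i j ≡ b) →
  ∀ i j → r i + s j ≡ 0ℚ
r+s-vanishes {P} {Q} p-prime q-prime p≢q b≢0 rows cols r s nonzero⇒b i j = begin
  r i + s j  ≡⟨ cong₂ _+_ (toWitness (count≡n⇒all R all-R i)) (toWitness (count≡n⇒all K all-K j)) ⟩
  ρ + - ρ    ≡⟨ +-inverseʳ ρ ⟩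
  0ℚ         ∎
  where
  open ≡-Reasoning
  ρ = r Fin.zero
  R : Fin (suc P) → Bool
  R i = ⌊ r i ≟ ρ ⌋
  K : Fin (suc Q) → Bool
  K j = ⌊ s j ≟ - ρ ⌋

  agree : ∀ {i j} → r i + s j ≡ 0ℚ → R i ≡ K j
  agree {i} {j} ri+sj≡0 = begin
    ⌊ r i ≟ ρ ⌋       ≡⟨ isYes≗does (r i ≟ ρ) ⟩
    does (r i ≟ ρ)    ≡⟨ does-⇔ (mk⇔ (λ ri≡ρ → trans sj≡-ri (cong -_ ri≡ρ))
                                     (λ sj≡-ρ → trans ri≡-sj (trans (cong -_ sj≡-ρ) (⁻¹-involutive ρ))))
                                (r i ≟ ρ) (s j ≟ - ρ) ⟩
    does (s j ≟ - ρ)  ≡⟨ isYes≗does (s j ≟ - ρ) ⟨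
    ⌊ s j ≟ - ρ ⌋     ∎
    where
    sj≡-ri = inverseʳ-unique (r i) (s j) ri+sj≡0
    ri≡-sj = inverseˡ-unique (r i) (s j) ri+sj≡0

  balance : suc Q ℕ.* count R ≡ suc P ℕ.* count K
  balance = block-count b≢0 rows cols R K (λ i j Ri≢Kj → nonzero⇒b i j (Ri≢Kj ∘ agree))

  all-R : count R ≡ suc P
  all-R = q*n≡p*k⇒n≡p p-prime q-prime p≢q balance (count>0 R {Fin.zero} (fromWitness {a? = ρ ≟ ρ} refl))
                      (count≤n R)

  all-K : count K ≡ suc Q
  all-K = ℕₚ.*-cancelˡ-≡ (count K) (suc Q) (suc P)
    (trans (sym balance) (trans (cong (suc Q ℕ.*_) all-R) (ℕₚ.*-comm (suc Q) (suc P))))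

-- Cyclotomic polytopes

cpVert-δ : ∀ P (i : Fin (suc P)) (a : Fin P) → cpVert (suc P) i a ≡ δ i (inject₁ a) - δ i (fromℕ P)
cpVert-δ P i a rewrite Finₚ.toℕ-inject₁ a | Finₚ.toℕ-fromℕ P
  with toℕ i ≡ᵇ toℕ a in i≡a | toℕ i ≡ᵇ P in i≡P
... | true  | true  =
  ⊥-elim (ℕₚ.<-irrefl (trans (sym (≡ᵇ-true (toℕ i) (toℕ a) i≡a)) (≡ᵇ-true (toℕ i) P i≡P)) (Finₚ.toℕ<n a))
  where
  ≡ᵇ-true : ∀ m n → (m ≡ᵇ n) ≡ true → m ≡ n
  ≡ᵇ-true m n e = ℕₚ.≡ᵇ⇒≡ m n (subst T (sym e) _)
... | true  | false = refl
... | false | true  = refl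
... | false | false = refl

Σℚ-cpVert-* : ∀ P (a : Fin P) (f : Fin (suc P) → ℚ) →
              Σℚ (λ i → cpVert (suc P) i a * f i) ≡ f (inject₁ a) - f (fromℕ P)
Σℚ-cpVert-* P a f = begin
  Σℚ (λ i → cpVert (suc P) i a * f i)
    ≡⟨ Σℚ-cong (λ i → cong (_* f i) (cpVert-δ P i a)) ⟩
  Σℚ (λ i → (δ i a′ - δ i L) * f i)
    ≡⟨ Σℚ-cong (λ i → [y-z]x≈yx-zx (f i) (δ i a′) (δ i L)) ⟩
  Σℚ (λ i → δ i a′ * f i - δ i L * f i)
    ≡⟨ Σℚ-distrib-- (λ i → δ i a′ * f i) (λ i → δ i L * f i) ⟩
  Σℚ (λ i → δ i a′ * f i) - Σℚ (λ i → δ i L * f i)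
    ≡⟨ cong₂ _-_ (Σℚ-δ f a′) (Σℚ-δ f L) ⟩
  f a′ - f L
    ∎
  where
  open ≡-Reasoning
  a′ = inject₁ a
  L = fromℕ P

Σℚ-cpVert : ∀ P (a : Fin P) → Σℚ (λ i → cpVert (suc P) i a) ≡ 0ℚ
Σℚ-cpVert P a = trans (Σℚ-cong (λ i → sym (*-identityʳ (cpVert (suc P) i a))))
                      (trans (Σℚ-cpVert-* P a (λ _ → 1ℚ)) (+-inverseʳ 1ℚ))

module _ (P Q : ℕ) where
  private
    g = cpqGens (suc P) (suc Q)
    v = cpVert (suc P)
    w = cpVert (suc Q)

  cpqGens-combine : ∀ i j a b → g (combine i j) (combine a b) ≡ v i a * w j b
  cpqGens-combine i j a b = cong₂ (λ (i , j) (a , b) → v i a * w j b)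
    (Finₚ.remQuot-combine {suc P} {suc Q} i j) (Finₚ.remQuot-combine {P} {Q} a b)

  cpq-rows : ∀ i k → Σℚ {suc Q} (λ j → g (combine i j) k) ≡ 0ℚ
  cpq-rows i = ∀-combine {P} {Q} λ a b → begin
    Σℚ (λ j → g (combine i j) (combine a b))  ≡⟨ Σℚ-cong (λ j → cpqGens-combine i j a b) ⟩
    Σℚ (λ j → v i a * w j b)                  ≡⟨ Σℚ-*ˡ (v i a) (λ j → w j b) ⟩
    v i a * Σℚ (λ j → w j b)                  ≡⟨ cong (v i a *_) (Σℚ-cpVert Q b) ⟩
    v i a * 0ℚ                                ≡⟨ *-zeroʳ (v i a) ⟩
    0ℚ                                        ∎
    where open ≡-Reasoning

  cpq-cols : ∀ j k → Σℚ {suc P} (λ i → g (combine i j) k) ≡ 0ℚ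
  cpq-cols j = ∀-combine {P} {Q} λ a b → begin
    Σℚ {suc P} (λ i → g (combine i j) (combine a b))  ≡⟨ Σℚ-cong (λ i → cpqGens-combine i j a b) ⟩
    Σℚ (λ i → v i a * w j b)                          ≡⟨ Σℚ-*ʳ (w j b) (λ i → v i a) ⟩
    Σℚ (λ i → v i a) * w j b                          ≡⟨ cong (_* w j b) (Σℚ-cpVert P a) ⟩
    0ℚ * w j b                                        ≡⟨ *-zeroˡ (w j b) ⟩
    0ℚ                                                ∎
    where open ≡-Reasoning

  cpq-lincomb : ∀ (C : Fin (suc P ℕ.* suc Q) → ℚ) a b → let C′ i j = C (combine i j) in
    lincomb C g (combine a b) ≡
      (C′ (inject₁ a) (inject₁ b) - C′ (inject₁ a) (fromℕ Q)) - (C′ (fromℕ P) (inject₁ b) - C′ (fromℕ P) (fromℕ Q))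
  cpq-lincomb C a b = begin
    Σℚ (λ t → C t * g t (combine a b))
      ≡⟨ Σℚ-combine (suc P) (suc Q) (λ t → C t * g t (combine a b)) ⟩
    Σℚ (λ i → Σℚ (λ j → C′ i j * g (combine i j) (combine a b)))
      ≡⟨ Σℚ-cong (λ i → Σℚ-cong (λ j → cong (C′ i j *_) (cpqGens-combine i j a b))) ⟩
    Σℚ (λ i → Σℚ (λ j → C′ i j * (v i a * w j b)))
      ≡⟨ Σℚ-cong (λ i → Σℚ-cong (λ j → rearrange (C′ i j) (v i a) (w j b))) ⟩
    Σℚ (λ i → Σℚ (λ j → v i a * (w j b * C′ i j)))
      ≡⟨ Σℚ-cong (λ i → Σℚ-*ˡ (v i a) (λ j → w j b * C′ i j)) ⟩
    Σℚ (λ i → v i a * Σℚ (λ j → w j b * C′ i j))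
      ≡⟨ Σℚ-cong (λ i → cong (v i a *_) (Σℚ-cpVert-* Q b (C′ i))) ⟩
    Σℚ (λ i → v i a * (C′ i (inject₁ b) - C′ i (fromℕ Q)))
      ≡⟨ Σℚ-cpVert-* P a (λ i → C′ i (inject₁ b) - C′ i (fromℕ Q)) ⟩
    (C′ (inject₁ a) (inject₁ b) - C′ (inject₁ a) (fromℕ Q)) - (C′ (fromℕ P) (inject₁ b) - C′ (fromℕ P) (fromℕ Q))
      ∎
    where
    open ≡-Reasoning
    C′ : Fin (suc P) → Fin (suc Q) → ℚ
    C′ i j = C (combine i j)
    rearrange : ∀ c x y → c * (x * y) ≡ x * (y * c)
    rearrange = solve 3 (λ c x y → c :* (x :* y) := x :* (y :* c)) refl

  cpq-kernel : ∀ (C : Fin (suc P ℕ.* suc Q) → ℚ) → lincomb C g ≈ₚ (λ _ → 0ℚ) →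
    let C′ i j = C (combine i j) in
    ∀ i j → C′ i j ≡ C′ i (fromℕ Q) + (C′ (fromℕ P) j - C′ (fromℕ P) (fromℕ Q))
  cpq-kernel C C↦0 i j with view i | view j
  ... | ‵fromℕ     | _          = solve 2 (λ x y → x := y :+ (x :- y)) refl
                                    (C (combine (fromℕ P) j)) (C (combine (fromℕ P) (fromℕ Q)))
  ... | ‵inject₁ a | ‵fromℕ     = solve 2 (λ x y → x := x :+ (y :- y)) refl
                                    (C (combine (inject₁ a) (fromℕ Q))) (C (combine (fromℕ P) (fromℕ Q)))
  ... | ‵inject₁ a | ‵inject₁ b = x-y≡0⇒x≡y _ _ (trans
        (solve 4 (λ x y z u → x :- (y :+ (z :- u)) := (x :- y) :- (z :- u)) refl
           (C (combine (inject₁ a) (inject₁ b))) (C (combine (inject₁ a) (fromℕ Q)))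
           (C (combine (fromℕ P) (inject₁ b))) (C (combine (fromℕ P) (fromℕ Q))))
        (trans (sym (cpq-lincomb C a b)) (C↦0 (combine a b))))

  cpq-properFacesIndependent : Prime (suc P) → Prime (suc Q) → suc P ≢ suc Q → ProperFacesIndependent g
  cpq-properFacesIndependent p-prime q-prime p≢q A b valid nonTight C C-vanishes C↦0 =
    ∀-combine {suc P} {suc Q} λ i j →
      trans (decomposition i j) (r+s-vanishes p-prime q-prime p≢q b≢0 rows cols r s r+s≢0⇒tight i j)
    where
    decomposition = cpq-kernel C C↦0
    r : Fin (suc P) → ℚ
    r i = C (combine i (fromℕ Q))
    s : Fin (suc Q) → ℚ
    s j = C (combine (fromℕ P) j) - C (combine (fromℕ P) (fromℕ Q))
    M : Fin (suc P) → Fin (suc Q) → ℚ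
    M i j = A · g (combine i j)
    rows : ∀ i → Σℚ (M i) ≡ 0ℚ
    rows i = Σℚ-·-zero A (λ j → g (combine i j)) (cpq-rows i)
    cols : ∀ j → Σℚ (λ i → M i j) ≡ 0ℚ
    cols j = Σℚ-·-zero A (λ (i : Fin (suc P)) → g (combine i j)) (cpq-cols j)
    b≢0 : b ≢ 0ℚ
    b≢0 = ≢-sym (<⇒≢ (centred⇒0<b {g = g} {A} valid nonTight
            (trans (Σℚ-combine (suc P) (suc Q) (λ t → A · g t)) (Σℚ-zero rows))))
    r+s≢0⇒tight : ∀ i j → r i + s j ≢ 0ℚ → M i j ≡ b
    r+s≢0⇒tight i j r+s≢0 = decidable-stable (M i j ≟ b)
      (r+s≢0 ∘ trans (sym (decomposition i j)) ∘ C-vanishes (combine i j))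

module _ (P : ℕ) where
  private
    g = cp2Gens (suc P)
    v = cpVert (suc P)

  cp2Gens-combine : ∀ j k k′ j′ → g (combine j k) (combine k′ j′) ≡ δ k k′ * v j j′
  cp2Gens-combine j k k′ j′ = trans
    (cong₂ (λ (j , k) (k′ , j′) → if toℕ k ≡ᵇ toℕ k′ then v j j′ else 0ℚ)
           (Finₚ.remQuot-combine {suc P} {suc P} j k) (Finₚ.remQuot-combine {suc P} {P} k′ j′))
    if-δ
    where
    if-δ : (if toℕ k ≡ᵇ toℕ k′ then v j j′ else 0ℚ) ≡ δ k k′ * v j j′
    if-δ with toℕ k ≡ᵇ toℕ k′
    ... | true  = sym (*-identityˡ (v j j′))
    ... | false = sym (*-zeroˡ (v j j′))

  cp2-cols : ∀ k x → Σℚ {suc P} (λ j → g (combine j k) x) ≡ 0ℚ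
  cp2-cols k = ∀-combine {suc P} {P} λ k′ j′ → begin
    Σℚ {suc P} (λ j → g (combine j k) (combine k′ j′))  ≡⟨ Σℚ-cong (λ j → cp2Gens-combine j k k′ j′) ⟩
    Σℚ (λ j → δ k k′ * v j j′)                          ≡⟨ Σℚ-*ˡ (δ k k′) (λ j → v j j′) ⟩
    δ k k′ * Σℚ (λ j → v j j′)                          ≡⟨ cong (δ k k′ *_) (Σℚ-cpVert P j′) ⟩
    δ k k′ * 0ℚ                                         ≡⟨ *-zeroʳ (δ k k′) ⟩
    0ℚ                                                  ∎
    where open ≡-Reasoning

  cp2-lincomb : ∀ (C : Fin (suc P ℕ.* suc P) → ℚ) k′ j′ →
    lincomb C g (combine k′ j′) ≡ C (combine (inject₁ j′) k′) - C (combine (fromℕ P) k′)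
  cp2-lincomb C k′ j′ = begin
    Σℚ (λ t → C t * g t (combine k′ j′))
      ≡⟨ Σℚ-combine (suc P) (suc P) (λ t → C t * g t (combine k′ j′)) ⟩
    Σℚ (λ j → Σℚ (λ k → C′ j k * g (combine j k) (combine k′ j′)))
      ≡⟨ Σℚ-cong (λ j → Σℚ-cong (λ k → cong (C′ j k *_) (cp2Gens-combine j k k′ j′))) ⟩
    Σℚ (λ j → Σℚ (λ k → C′ j k * (δ k k′ * v j j′)))
      ≡⟨ Σℚ-cong (λ j → Σℚ-cong (λ k → rearrange (C′ j k) (δ k k′) (v j j′))) ⟩
    Σℚ (λ j → Σℚ (λ k → v j j′ * (δ k k′ * C′ j k)))
      ≡⟨ Σℚ-cong (λ j → Σℚ-*ˡ (v j j′) (λ k → δ k k′ * C′ j k)) ⟩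
    Σℚ (λ j → v j j′ * Σℚ (λ k → δ k k′ * C′ j k))
      ≡⟨ Σℚ-cong (λ j → cong (v j j′ *_) (Σℚ-δ (C′ j) k′)) ⟩
    Σℚ (λ j → v j j′ * C′ j k′)
      ≡⟨ Σℚ-cpVert-* P j′ (λ j → C′ j k′) ⟩
    C′ (inject₁ j′) k′ - C′ (fromℕ P) k′
      ∎
    where
    open ≡-Reasoning
    C′ : Fin (suc P) → Fin (suc P) → ℚ
    C′ j k = C (combine j k)
    rearrange : ∀ c d x → c * (d * x) ≡ x * (d * c)
    rearrange = solve 3 (λ c d x → c :* (d :* x) := x :* (d :* c)) refl

  cp2-kernel : ∀ (C : Fin (suc P ℕ.* suc P) → ℚ) → lincomb C g ≈ₚ (λ _ → 0ℚ) →
    ∀ j k → C (combine j k) ≡ C (combine (fromℕ P) k)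
  cp2-kernel C C↦0 j k with view j
  ... | ‵fromℕ      = refl
  ... | ‵inject₁ j′ = x-y≡0⇒x≡y _ _ (trans (sym (cp2-lincomb C k j′)) (C↦0 (combine k j′)))

  cp2-properFacesIndependent : ProperFacesIndependent g
  cp2-properFacesIndependent A b valid nonTight C C-vanishes C↦0 =
    ∀-combine {suc P} {suc P} λ j k → trans (cp2-kernel C C↦0 j k) (column-vanishes k)
    where
    M : Fin (suc P) → Fin (suc P) → ℚ
    M j k = A · g (combine j k)

    cols : ∀ k → Σℚ (λ j → M j k) ≡ 0ℚ
    cols k = Σℚ-·-zero A (λ (j : Fin (suc P)) → g (combine j k)) (cp2-cols k)

    0<b : 0ℚ < b
    0<b = centred⇒0<b {g = g} {A} valid nonTight
            (trans (Σℚ-combine (suc P) (suc P) (λ t → A · g t)) (trans (Σℚ-comm M) (Σℚ-zero cols)))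

    column-vanishes : ∀ k → C (combine (fromℕ P) k) ≡ 0ℚ
    column-vanishes k = decidable-stable (C (combine (fromℕ P) k) ≟ 0ℚ) λ CLk≢0 →
      let tight : ∀ j → M j k ≡ b
          tight j = decidable-stable (M j k ≟ b) λ Mjk≢b →
            CLk≢0 (trans (sym (cp2-kernel C C↦0 j k)) (C-vanishes (combine j k) Mjk≢b))
      in <-irrefl refl (begin-strict
           0ℚ                     ≡⟨ Σℚ-zero {suc P} (λ _ → refl) ⟨
           Σℚ {suc P} (λ _ → 0ℚ)  <⟨ Σℚ-mono-< {suc P} (λ _ → <⇒≤ 0<b) Fin.zero 0<b ⟩
           Σℚ {suc P} (λ _ → b)   ≡⟨ Σℚ-cong tight ⟨
           Σℚ (λ j → M j k)       ≡⟨ cols k ⟩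
           0ℚ                     ∎)
      where open ≤-Reasoning

proposition4p6 : (∀ (p q : ℕ) → Prime p → Prime q → p ≢ q → Simplicial (cpqGens p q))
    × (∀ (p : ℕ) → Prime p → Simplicial (cp2Gens p))
proposition4p6 = cpq-simplicial , cp2-simplicial
  where
  cpq-simplicial : ∀ (p q : ℕ) → Prime p → Prime q → p ≢ q → Simplicial (cpqGens p q)
  cpq-simplicial zero    _       p-prime _       _   = ⊥-elim (¬prime[0] p-prime)
  cpq-simplicial (suc P) zero    _       q-prime _   = ⊥-elim (¬prime[0] q-prime)
  cpq-simplicial (suc P) (suc Q) p-prime q-prime p≢q =
    properFacesIndependent⇒simplicial (cpq-properFacesIndependent P Q p-prime q-prime p≢q)

  cp2-simplicial : ∀ (p : ℕ) → Prime p → Simplicial (cp2Gens p)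
  cp2-simplicial zero    p-prime = ⊥-elim (¬prime[0] p-prime)
  cp2-simplicial (suc P) _       = properFacesIndependent⇒simplicial (cp2-properFacesIndependent P)
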